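{- Let $\mathcal{G} = (G, S, \mu, l)$ be a reconciled gene tree that is least duplication-resolved, and let $u, v \in V(G)$ be such that $v \prec_G u$ (i.e., $v$ is a proper descendant of $u$ in $G$). Then $\mu(u) \neq \mu(v)$ or $l(u) \neq l(v)$.
   Context: All trees are rooted. For a rooted tree $T$, $u \preceq_T v$ means $v$ lies on the path from the root of $T$ to $u$; $u \prec_T v$ means additionally $u \neq v$. A species tree $S$ is a rooted binary tree. A reconciled gene tree is a tuple $\mathcal{G} = (G, S, \mu, l)$ where $G$ is a rooted tree in which every internal node has at least two children, $S$ is a species tree, $\mu : V(G) \to V(S)$ and $l : V(G) \to \{dup, spec, extant\}$, such that: (1) every leaf $v$ of $G$ has $\mu(v) \in L(S)$ and $l(v) = extant$, and every internal node $w$ has $l(w) \in \{dup, spec\}$; (2) (time-consistency) $u \preceq_G v$ implies $\mu(u) \preceq_S \mu(v)$; (3) if $l(v) = spec$, then $\mu(v)$ is an internal node of $S$, $v$ has exactly two children $v_1, v_2$, and, denoting by $s_1, s_2$ the two children of $\mu(v)$ in $S$, either $\mu(v_1) \preceq_S s_1$ and $\mu(v_2) \preceq_S s_2$, or $\mu(v_2) \preceq_S s_1$ and $\mu(v_1) \preceq_S s_2$. An edge $uv$ of $G$ with $u$ the parent of $v$ is redundant if $\mu(u) = \mu(v)$ and $l(u) = l(v) = dup$. $\mathcal{G}$ is least duplication-resolved if $G$ has no redundant edge. -}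

module Defs where

open import Data.Nat using (ℕ; _≥_)
open import Data.Fin using (Fin)
open import Data.List using (List; []; length; lookup)
open import Data.Product using (Σ; _×_; ∃; ∃-syntax)
open import Data.Sum using (_⊎_)
open import Relation.Binary.PropositionalEquality using (_≡_; _≢_)
open import Relation.Nullary using (¬_)

data Tree : Set where
  node : List Tree → Tree

children : Tree → List Tree
children (node ts) = ts

-- Vertices of a tree, given as paths from the root.
data Pos : Tree → Set where
  here  : ∀ {t} → Pos t
  child : (ts : List Tree) (i : Fin (length ts)) → Pos (lookup ts i) → Pos (node ts)

subtree : ∀ {t} → Pos t → Tree
subtree {t} here = t
subtree (child _ i p) = subtree p

deg : ∀ {t} → Pos t → ℕ
deg p = length (children (subtree p))

IsLeaf : ∀ {t} → Pos t → Set
IsLeaf p = deg p ≡ 0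

IsInternal : ∀ {t} → Pos t → Set
IsInternal p = ¬ IsLeaf p

-- u ⪯ v : v lies on the path from the root to u
data _⪯_ : ∀ {t} → Pos t → Pos t → Set where
  ⪯-root  : ∀ {t} {u : Pos t} → u ⪯ here
  ⪯-child : ∀ {ts} {i : Fin (length ts)} {u v : Pos (lookup ts i)} →
            u ⪯ v → child ts i u ⪯ child ts i v

_≺_ : ∀ {t} → Pos t → Pos t → Set
u ≺ v = u ⪯ v × u ≢ v

data ChildOf : ∀ {t} → Pos t → Pos t → Set where
  co-here : ∀ {ts} {i : Fin (length ts)} → ChildOf (child ts i here) here
  co-step : ∀ {ts} {i : Fin (length ts)} {u v : Pos (lookup ts i)} →
            ChildOf v u → ChildOf (child ts i v) (child ts i u)

IsBinary : Tree → Set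
IsBinary S = (s : Pos S) → deg s ≡ 0 ⊎ deg s ≡ 2

IsGeneTreeShape : Tree → Set
IsGeneTreeShape G = (v : Pos G) → IsInternal v → deg v ≥ 2

data Label : Set where
  dup spec extant : Label

SpecCondition : ∀ {G S} → (Pos G → Pos S) → Pos G → Set
SpecCondition {G} {S} μ v =
  IsInternal (μ v) ×
  (Σ (Pos G) λ v₁ → Σ (Pos G) λ v₂ →
     v₁ ≢ v₂ × ChildOf v₁ v × ChildOf v₂ v ×
     ((w : Pos G) → ChildOf w v → w ≡ v₁ ⊎ w ≡ v₂) ×
     ((s₁ s₂ : Pos S) → s₁ ≢ s₂ → ChildOf s₁ (μ v) → ChildOf s₂ (μ v) →
        (μ v₁ ⪯ s₁ × μ v₂ ⪯ s₂) ⊎ (μ v₂ ⪯ s₁ × μ v₁ ⪯ s₂)))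

record IsReconciledGeneTree (G S : Tree) (μ : Pos G → Pos S) (l : Pos G → Label) : Set where
  field
    geneShape   : IsGeneTreeShape G
    speciesBin  : IsBinary S
    leafMap     : (v : Pos G) → IsLeaf v → IsLeaf (μ v)
    leafLabel   : (v : Pos G) → IsLeaf v → l v ≡ extant
    innerLabel  : (w : Pos G) → IsInternal w → l w ≢ extant
    timeConsist : (u v : Pos G) → u ⪯ v → μ u ⪯ μ v
    specCond    : (v : Pos G) → l v ≡ spec → SpecCondition μ v

Redundant : ∀ {G S} → (Pos G → Pos S) → (Pos G → Label) → Pos G → Pos G → Set
Redundant μ l u v = μ u ≡ μ v × l u ≡ dup × l v ≡ dup

LeastDupResolved : ∀ {G S} → (Pos G → Pos S) → (Pos G → Label) → Set
LeastDupResolved {G} μ l = (u v : Pos G) → ChildOf v u → ¬ Redundant μ l u v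

-- Walk from u towards v to the child w of u on that path; time-consistency squeezes
-- μ w between μ v and μ u, so μ w = μ u.  A speciation must send each child strictly
-- below its species, so u is not a speciation, and for the same reason neither is w
-- unless w = v.  An extant u has no child.  So u is a duplication, and then w is
-- either v or another duplication, and the edge uw is redundant.

module Submission where

open import Defs
open import Data.Empty using (⊥; ⊥-elim)
open import Data.Fin using (zero; suc)
open import Data.List using ([]; _∷_)
open import Data.Nat using (ℕ; suc; _≤_; z≤n; s≤s)
open import Data.Nat.Properties using (≤-trans; ≤-reflexive; 1+n≰n)
open import Data.Product using (Σ; _×_; _,_)
open import Data.Sum using (_⊎_; inj₁; inj₂)
open import Relation.Binary.PropositionalEquality using (_≡_; _≢_; refl; sym; trans; cong; subst)
open import Relation.Nullary using (¬_; Dec; yes; no)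

_≟-label_ : (a b : Label) → Dec (a ≡ b)
dup    ≟-label dup    = yes refl
dup    ≟-label spec   = no λ ()
dup    ≟-label extant = no λ ()
spec   ≟-label dup    = no λ ()
spec   ≟-label spec   = yes refl
spec   ≟-label extant = no λ ()
extant ≟-label dup    = no λ ()
extant ≟-label spec   = no λ ()
extant ≟-label extant = yes refl

depth : ∀ {t} → Pos t → ℕ
depth here          = 0
depth (child _ _ p) = suc (depth p)

⪯⇒depth≥ : ∀ {t} {x y : Pos t} → x ⪯ y → depth y ≤ depth x
⪯⇒depth≥ ⪯-root      = z≤n
⪯⇒depth≥ (⪯-child p) = s≤s (⪯⇒depth≥ p)

⪯-trans : ∀ {t} {x y z : Pos t} → x ⪯ y → y ⪯ z → x ⪯ z
⪯-trans _           ⪯-root      = ⪯-root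
⪯-trans (⪯-child p) (⪯-child q) = ⪯-child (⪯-trans p q)

⪯-antisym : ∀ {t} {x y : Pos t} → x ⪯ y → y ⪯ x → x ≡ y
⪯-antisym ⪯-root      ⪯-root      = refl
⪯-antisym (⪯-child p) (⪯-child q) = cong (child _ _) (⪯-antisym p q)

⪯⇒≡⊎≺ : ∀ {t} {x y : Pos t} → x ⪯ y → x ≡ y ⊎ x ≺ y
⪯⇒≡⊎≺ {x = here}        ⪯-root = inj₁ refl
⪯⇒≡⊎≺ {x = child _ _ _} ⪯-root = inj₂ (⪯-root , λ ())
⪯⇒≡⊎≺ (⪯-child p) with ⪯⇒≡⊎≺ p
... | inj₁ refl     = inj₁ refl
... | inj₂ (q , x≢y) = inj₂ (⪯-child q , λ { refl → x≢y refl })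

ChildOf⇒depth : ∀ {t} {x y : Pos t} → ChildOf x y → depth x ≡ suc (depth y)
ChildOf⇒depth co-here     = refl
ChildOf⇒depth (co-step c) = cong suc (ChildOf⇒depth c)

ChildOf⇒⪯ : ∀ {t} {x y : Pos t} → ChildOf x y → x ⪯ y
ChildOf⇒⪯ co-here     = ⪯-root
ChildOf⇒⪯ (co-step c) = ⪯-child (ChildOf⇒⪯ c)

ChildOf⇒parent⋠ : ∀ {t} {x y : Pos t} → ChildOf x y → ¬ y ⪯ x
ChildOf⇒parent⋠ c y⪯x =
  1+n≰n (≤-trans (≤-reflexive (sym (ChildOf⇒depth c))) (⪯⇒depth≥ y⪯x))

ChildOf⇒internal : ∀ {t} {x y : Pos t} → ChildOf x y → IsInternal y
ChildOf⇒internal (co-here {[]} {()})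
ChildOf⇒internal (co-here {_ ∷ _}) ()
ChildOf⇒internal (co-step c) = ChildOf⇒internal c

≺⇒ChildOf-on-path : ∀ {t} {x y : Pos t} → x ≺ y → Σ (Pos t) λ w → ChildOf w y × x ⪯ w
≺⇒ChildOf-on-path {x = here}         (⪯-root , x≢y) = ⊥-elim (x≢y refl)
≺⇒ChildOf-on-path {x = child ts i _} (⪯-root , _)   = child ts i here , co-here , ⪯-child ⪯-root
≺⇒ChildOf-on-path (⪯-child p , x≢y)
  with ≺⇒ChildOf-on-path (p , λ { refl → x≢y refl })
... | w , c , q = child _ _ w , co-step c , ⪯-child q

≺⇒internal : ∀ {t} {x y : Pos t} → x ≺ y → IsInternal y
≺⇒internal x≺y with ≺⇒ChildOf-on-path x≺y
... | _ , c , _ = ChildOf⇒internal c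

deg≡2⇒two-children : ∀ {t} (p : Pos t) → deg p ≡ 2 →
  Σ (Pos t) λ s₁ → Σ (Pos t) λ s₂ → s₁ ≢ s₂ × ChildOf s₁ p × ChildOf s₂ p
deg≡2⇒two-children {node (_ ∷ _ ∷ [])} here refl =
  child _ zero here , child _ (suc zero) here , (λ ()) , co-here , co-here
deg≡2⇒two-children (child ts i p) eq with deg≡2⇒two-children p eq
... | s₁ , s₂ , s₁≢s₂ , c₁ , c₂ =
  child ts i s₁ , child ts i s₂ , (λ { refl → s₁≢s₂ refl }) , co-step c₁ , co-step c₂

module Reconciled {G S : Tree} {μ : Pos G → Pos S} {l : Pos G → Label}
                  (R : IsReconciledGeneTree G S μ l) where
  open IsReconciledGeneTree R

  ≺⇒label≢extant : {x y : Pos G} → x ≺ y → l y ≢ extant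
  ≺⇒label≢extant x≺y = innerLabel _ (≺⇒internal x≺y)

  μ-squeeze : {x w y : Pos G} → x ⪯ w → w ⪯ y → μ y ≡ μ x → μ w ≡ μ y
  μ-squeeze x⪯w w⪯y μy≡μx =
    ⪯-antisym (timeConsist _ _ w⪯y) (subst (_⪯ μ _) (sym μy≡μx) (timeConsist _ _ x⪯w))

  spec⇒μ-child⪯some-child : {x w : Pos G} → l x ≡ spec → ChildOf w x →
    Σ (Pos S) λ s → ChildOf s (μ x) × μ w ⪯ s
  spec⇒μ-child⪯some-child {x} {w} lx c with specCond x lx
  ... | μx-internal , v₁ , v₂ , _ , _ , _ , w∈ , separated
    with speciesBin (μ x)
  ... | inj₁ leaf = ⊥-elim (μx-internal leaf)
  ... | inj₂ two  with deg≡2⇒two-children (μ x) two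
  ... | s₁ , s₂ , s₁≢s₂ , c₁ , c₂ = pick (w∈ w c) (separated s₁ s₂ s₁≢s₂ c₁ c₂)
    where
    pick : w ≡ v₁ ⊎ w ≡ v₂ → (μ v₁ ⪯ s₁ × μ v₂ ⪯ s₂) ⊎ (μ v₂ ⪯ s₁ × μ v₁ ⪯ s₂) →
           Σ (Pos S) λ s → ChildOf s (μ x) × μ w ⪯ s
    pick (inj₁ refl) (inj₁ (p , _)) = s₁ , c₁ , p
    pick (inj₁ refl) (inj₂ (_ , q)) = s₂ , c₂ , q
    pick (inj₂ refl) (inj₁ (_ , q)) = s₂ , c₂ , q
    pick (inj₂ refl) (inj₂ (p , _)) = s₁ , c₁ , p

  spec⇒μ-descendant≢ : {x y : Pos G} → l x ≡ spec → y ≺ x → μ y ≢ μ x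
  spec⇒μ-descendant≢ lx y≺x μy≡μx with ≺⇒ChildOf-on-path y≺x
  ... | w , c , y⪯w with spec⇒μ-child⪯some-child lx c
  ... | s , cs , μw⪯s =
    ChildOf⇒parent⋠ cs (subst (_⪯ s) μy≡μx (⪯-trans (timeConsist _ _ y⪯w) μw⪯s))

  module _ (L : LeastDupResolved μ l) where

    dup⇒no-equal-descendant : {u v : Pos G} → l u ≡ dup → v ≺ u → μ u ≡ μ v → l v ≢ dup
    dup⇒no-equal-descendant {u} {v} lu v≺u μu≡μv lv with ≺⇒ChildOf-on-path v≺u
    ... | w , c , v⪯w = on-path (⪯⇒≡⊎≺ v⪯w)
      where
      μw≡μu : μ w ≡ μ u
      μw≡μu = μ-squeeze v⪯w (ChildOf⇒⪯ c) μu≡μv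

      on-path : v ≡ w ⊎ v ≺ w → ⊥
      on-path (inj₁ refl) = L u v c (μu≡μv , lu , lv)
      on-path (inj₂ v≺w) with l w in lw
      ... | dup    = L u w c (sym μw≡μu , lu , lw)
      ... | spec   = spec⇒μ-descendant≢ lw v≺w (sym (trans μw≡μu μu≡μv))
      ... | extant = ≺⇒label≢extant v≺w lw

    no-equal-descendant : {u v : Pos G} → v ≺ u → μ u ≡ μ v → l u ≡ l v → ⊥
    no-equal-descendant {u} v≺u μu≡μv lu≡lv with l u in lu
    ... | extant = ≺⇒label≢extant v≺u lu
    ... | spec   = spec⇒μ-descendant≢ lu v≺u (sym μu≡μv)
    ... | dup    = dup⇒no-equal-descendant lu v≺u μu≡μv (sym lu≡lv)

lemma1 : (G S : Tree) (μ : Pos G → Pos S) (l : Pos G → Label) →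
    IsReconciledGeneTree G S μ l → LeastDupResolved μ l →
    (u v : Pos G) → v ≺ u → μ u ≢ μ v ⊎ l u ≢ l v
lemma1 G S μ l R L u v v≺u with l u ≟-label l v
... | yes lu≡lv = inj₁ λ μu≡μv → Reconciled.no-equal-descendant R L v≺u μu≡μv lu≡lv
... | no  lu≢lv = inj₂ lu≢lv
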